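{- Let $m\ge2$ and consider $m$-constellations, i.e. the specialization $t_k=0$ for $k\neq m$ and $\widetilde t_\ell=0$ whenever $m\nmid \ell$. Let $x(z),y(z)$ be the Laurent polynomials in $z$ giving the rational parametrization $Y(x(z))=y(z)$ of the curve of $(x,Y(x))$, and let $\xi,\chi$ be the Laurent polynomials with $\xi(z^m)=x(z)y(z)$ and $\chi(z^m)=x(z)^m$. Define $\Omega(s)=\xi(s)^2/\chi(s)$, $a(s)=1-\chi(s)/\xi(s)$, the $2$-form $\tau=\mathrm d\Omega\wedge\mathrm d a$, and $\varphi(z)=z^m$. Then $\varphi^*\tau=m\,\mathrm dx\wedge\mathrm dy$, where $x=x(z)$, $y=y(z)$.
   Context: $Y(x)=\frac1c(W(x)-V'(x))$ where $V(x)=-\sum_{i=2}^d t_ix^i/i$ and $W(x)$ is the generating function (in $x^{ -1}$) of hypermaps with a monochromatic boundary, counted with weight $t$ per vertex, $c^{ -1}$ per edge and weights $t_i$, $\widetilde t_j$ per inner white face of degree $i$, black face of degree $j$. It is known that $(x,Y(x))$ admits a parametrization $x(z)=\gamma z+\sum_{k\ge0}\alpha_kz^{ -k}$, $y(z)=\gamma z^{ -1}+\sum_{k\ge0}\beta_kz^k$ (finite sums) with $Y(x(z))=y(z)$; for $m$-constellations, $x(z)y(z)$ and $x(z)^m$ are Laurent polynomials in $z^m$. (The pair $(\Omega,a)$ parametrizes $(\omega,\widehat f(\omega)+c)$ for the alternating boundary.) -}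

module Defs where

open import Level using (_⊔_)
open import Data.Nat using (ℕ; zero; suc)
open import Algebra.Bundles using (CommutativeRing)

-- Generic algebraic calculus of differential 2-forms.
-- A 2-form  df ∧ dg  is determined by its values on all pairs of
-- derivations (vector fields) D₁ D₂ :  (df ∧ dg)(D₁,D₂) = D₁f·D₂g − D₂f·D₁g.

module _ {c ℓ} (R : CommutativeRing c ℓ) where
  open CommutativeRing R

  record Derivation : Set (c ⊔ ℓ) where
    field
      D       : Carrier → Carrier
      D-cong  : ∀ {u v} → u ≈ v → D u ≈ D v
      D-+     : ∀ u v → D (u + v) ≈ D u + D v
      D-*     : ∀ u v → D (u * v) ≈ u * D v + v * D u

  open Derivation public

  wedge : Derivation → Derivation → Carrier → Carrier → Carrier
  wedge D₁ D₂ f g = D D₁ f * D D₂ g - D D₂ f * D D₁ g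

  pow : Carrier → ℕ → Carrier
  pow u zero    = 1#
  pow u (suc n) = u * pow u n

  natR : ℕ → Carrier
  natR zero    = 0#
  natR (suc n) = 1# + natR n

  Ωfun : (ξ χ⁻¹ : Carrier) → Carrier
  Ωfun ξ χ⁻¹ = ξ * ξ * χ⁻¹

  afun : (χ ξ⁻¹ : Carrier) → Carrier
  afun χ ξ⁻¹ = 1# - χ * ξ⁻¹

{-# OPTIONS --safe #-}
-- For fixed f the map g ↦ df ∧ dg = (D₁ f) D₂ g − (D₂ f) D₁ g is itself a derivation, so
-- the rules of one-variable calculus (Leibniz, d(1 − u) = −du, d(u⁻¹) = −u⁻² du,
-- x d(xⁿ) = n xⁿ dx) hold in either slot of the wedge. They give dΩ ∧ da = −χ⁻¹ dξ ∧ dχ,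
-- and for ξ = xy, χ = xᵐ one has dξ ∧ dχ = (x dy + y dx) ∧ m xᵐ⁻¹ dx = −m χ dx ∧ dy.
module Submission where

open import Data.Nat using (ℕ; zero; suc; _≤_)
open import Algebra.Bundles using (CommutativeRing)
open import Algebra.Morphism.Structures using (module RingMorphisms)
import Algebra.Properties.Ring as RingProperties
import Algebra.Properties.AbelianGroup as AbelianGroupProperties
import Algebra.Properties.CommutativeSemigroup as CommutativeSemigroupProperties
import Algebra.Solver.Ring.NaturalCoefficients.Default as NaturalCoefficientSolver
import Relation.Binary.Reasoning.Setoid as SetoidReasoning
open import Defs

module DifferentialCalculus {c ℓ} (R : CommutativeRing c ℓ) where
  open CommutativeRing R
  open SetoidReasoning setoid
  open RingProperties ring using (-‿distribʳ-*; x[y-z]≈xy-xz; x+x≈x⇒x≈0)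
  open AbelianGroupProperties +-abelianGroup
    using (⁻¹-∙-comm; ⁻¹-anti-homo‿-; inverseʳ-unique; ⁻¹-involutive; ε⁻¹≈ε)
  open CommutativeSemigroupProperties *-commutativeSemigroup using (x∙yz≈y∙xz; xy∙z≈y∙xz; interchange)
  open CommutativeSemigroupProperties +-commutativeSemigroup using () renaming (interchange to +-interchange)
  open NaturalCoefficientSolver commutativeSemiring using (solve; _:=_; _:+_; _:*_; con)

  [p+q]-[r+s]≈[p-r]+[q-s] : ∀ p q r s → (p + q) - (r + s) ≈ (p - r) + (q - s)
  [p+q]-[r+s]≈[p-r]+[q-s] p q r s = begin
    (p + q) + - (r + s)     ≈⟨ +-congˡ (⁻¹-∙-comm r s) ⟨
    (p + q) + (- r + - s)   ≈⟨ +-interchange p q (- r) (- s) ⟩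
    (p + - r) + (q + - s)   ∎

  module _ (d : Derivation R) where

    D-0# : D d 0# ≈ 0#
    D-0# = x+x≈x⇒x≈0 (D d 0#) (begin
      D d 0# + D d 0#   ≈⟨ D-+ d 0# 0# ⟨
      D d (0# + 0#)     ≈⟨ D-cong d (+-identityʳ 0#) ⟩
      D d 0#            ∎)

    D-1# : D d 1# ≈ 0#
    D-1# = x+x≈x⇒x≈0 (D d 1#) (begin
      D d 1# + D d 1#              ≈⟨ +-cong (*-identityˡ _) (*-identityˡ _) ⟨
      1# * D d 1# + 1# * D d 1#    ≈⟨ D-* d 1# 1# ⟨
      D d (1# * 1#)                ≈⟨ D-cong d (*-identityʳ 1#) ⟩
      D d 1#                       ∎)

    D-‿ : ∀ u → D d (- u) ≈ - D d u
    D-‿ u = inverseʳ-unique (D d u) (D d (- u)) (begin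
      D d u + D d (- u)   ≈⟨ D-+ d u (- u) ⟨
      D d (u - u)         ≈⟨ D-cong d (-‿inverseʳ u) ⟩
      D d 0#              ≈⟨ D-0# ⟩
      0#                  ∎)

    D-1#- : ∀ u → D d (1# - u) ≈ - D d u
    D-1#- u = begin
      D d (1# - u)          ≈⟨ D-+ d 1# (- u) ⟩
      D d 1# + D d (- u)    ≈⟨ +-cong D-1# (D-‿ u) ⟩
      0# + - D d u          ≈⟨ +-identityˡ _ ⟩
      - D d u               ∎

    D-inverse : ∀ {u v} → u * v ≈ 1# → D d v ≈ - (v * v * D d u)
    D-inverse {u} {v} uv≈1 = begin
      D d v                  ≈⟨ *-identityˡ _ ⟨
      1# * D d v             ≈⟨ *-congʳ (trans (*-comm v u) uv≈1) ⟨
      v * u * D d v          ≈⟨ *-assoc v u (D d v) ⟩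
      v * (u * D d v)        ≈⟨ *-congˡ u*Dv≈-v*Du ⟩
      v * - (v * D d u)      ≈⟨ -‿distribʳ-* v (v * D d u) ⟨
      - (v * (v * D d u))    ≈⟨ -‿cong (*-assoc v v (D d u)) ⟨
      - (v * v * D d u)      ∎
      where
      u*Dv≈-v*Du : u * D d v ≈ - (v * D d u)
      u*Dv≈-v*Du = inverseʳ-unique (v * D d u) (u * D d v) (begin
        v * D d u + u * D d v   ≈⟨ +-comm _ _ ⟩
        u * D d v + v * D d u   ≈⟨ D-* d u v ⟨
        D d (u * v)             ≈⟨ D-cong d uv≈1 ⟩
        D d 1#                  ≈⟨ D-1# ⟩
        0#                      ∎)

    D-pow-constant : ∀ {x} → D d x ≈ 0# → ∀ n → D d (pow R x n) ≈ 0#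
    D-pow-constant Dx≈0 zero    = D-1#
    D-pow-constant {x} Dx≈0 (suc n) = begin
      D d (x * pow R x n)                           ≈⟨ D-* d x (pow R x n) ⟩
      x * D d (pow R x n) + pow R x n * D d x       ≈⟨ +-cong (*-congˡ (D-pow-constant Dx≈0 n)) (*-congˡ Dx≈0) ⟩
      x * 0# + pow R x n * 0#                       ≈⟨ +-cong (zeroʳ x) (zeroʳ _) ⟩
      0# + 0#                                       ≈⟨ +-identityʳ 0# ⟩
      0#                                            ∎

    x*D-pow : ∀ x n → x * D d (pow R x n) ≈ natR R n * pow R x n * D d x
    x*D-pow x zero = begin
      x * D d 1#         ≈⟨ *-congˡ D-1# ⟩
      x * 0#             ≈⟨ zeroʳ x ⟩
      0#                 ≈⟨ zeroˡ _ ⟨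
      0# * D d x         ≈⟨ *-congʳ (zeroˡ 1#) ⟨
      0# * 1# * D d x    ∎
    x*D-pow x (suc n) = begin
      x * D d (x * P)                      ≈⟨ *-congˡ (D-* d x P) ⟩
      x * (x * D d P + P * D d x)          ≈⟨ distribˡ x _ _ ⟩
      x * (x * D d P) + x * (P * D d x)    ≈⟨ +-congʳ (*-congˡ (x*D-pow x n)) ⟩
      x * (N * P * D d x) + x * (P * D d x)
        ≈⟨ solve 4 (λ x N P Dx → x :* (N :* P :* Dx) :+ x :* (P :* Dx) := (con 1 :+ N) :* (x :* P) :* Dx)
                 refl x N P (D d x) ⟩
      (1# + N) * (x * P) * D d x           ∎
      where
      P = pow R x n
      N = natR R n

  module _ (D₁ D₂ : Derivation R) where

    infix 8 _∧_
    _∧_ : Carrier → Carrier → Carrier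
    _∧_ = wedge R D₁ D₂

    wedge-cong : ∀ {f f′ g g′} → f ≈ f′ → g ≈ g′ → f ∧ g ≈ f′ ∧ g′
    wedge-cong f≈f′ g≈g′ =
      +-cong (*-cong (D-cong D₁ f≈f′) (D-cong D₂ g≈g′)) (-‿cong (*-cong (D-cong D₂ f≈f′) (D-cong D₁ g≈g′)))

    wedge-self : ∀ f → f ∧ f ≈ 0#
    wedge-self f = trans (+-congˡ (-‿cong (*-comm (D D₂ f) (D D₁ f)))) (-‿inverseʳ _)

    wedge-antisym : ∀ f g → f ∧ g ≈ - (g ∧ f)
    wedge-antisym f g = begin
      D D₁ f * D D₂ g - D D₂ f * D D₁ g    ≈⟨ +-cong (*-comm _ _) (-‿cong (*-comm _ _)) ⟩
      D D₂ g * D D₁ f - D D₁ g * D D₂ f    ≈⟨ ⁻¹-anti-homo‿- _ _ ⟨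
      - (g ∧ f)                            ∎

    wedgeDerivation : Carrier → Derivation R
    wedgeDerivation f = record
      { D      = f ∧_
      ; D-cong = wedge-cong refl
      ; D-+    = λ u v → begin
          a * D D₂ (u + v) - b * D D₁ (u + v)                 ≈⟨ +-cong (*-congˡ (D-+ D₂ u v)) (-‿cong (*-congˡ (D-+ D₁ u v))) ⟩
          a * (D D₂ u + D D₂ v) - b * (D D₁ u + D D₁ v)       ≈⟨ +-cong (distribˡ a _ _) (-‿cong (distribˡ b _ _)) ⟩
          (a * D D₂ u + a * D D₂ v) - (b * D D₁ u + b * D D₁ v) ≈⟨ [p+q]-[r+s]≈[p-r]+[q-s] _ _ _ _ ⟩
          f ∧ u + f ∧ v                                       ∎
      ; D-*    = λ u v → begin
          a * D D₂ (u * v) - b * D D₁ (u * v)                 ≈⟨ +-cong (*-congˡ (D-* D₂ u v)) (-‿cong (*-congˡ (D-* D₁ u v))) ⟩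
          a * (u * D D₂ v + v * D D₂ u) - b * (u * D D₁ v + v * D D₁ u)
            ≈⟨ +-cong (distribˡ a _ _) (-‿cong (distribˡ b _ _)) ⟩
          (a * (u * D D₂ v) + a * (v * D D₂ u)) - (b * (u * D D₁ v) + b * (v * D D₁ u))
            ≈⟨ [p+q]-[r+s]≈[p-r]+[q-s] _ _ _ _ ⟩
          (a * (u * D D₂ v) - b * (u * D D₁ v)) + (a * (v * D D₂ u) - b * (v * D D₁ u))
            ≈⟨ +-cong (factor-out u (D D₂ v) (D D₁ v)) (factor-out v (D D₂ u) (D D₁ u)) ⟩
          u * (f ∧ v) + v * (f ∧ u)                           ∎
      }
      where
      a = D D₁ f
      b = D D₂ f
      factor-out : ∀ u p q → a * (u * p) - b * (u * q) ≈ u * (a * p - b * q)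
      factor-out u p q = begin
        a * (u * p) - b * (u * q)   ≈⟨ +-cong (x∙yz≈y∙xz a u p) (-‿cong (x∙yz≈y∙xz b u q)) ⟩
        u * (a * p) - u * (b * q)   ≈⟨ x[y-z]≈xy-xz u _ _ ⟨
        u * (a * p - b * q)         ∎

    wedge-*ˡ : ∀ f g h → (f * g) ∧ h ≈ f * (g ∧ h) + g * (f ∧ h)
    wedge-*ˡ f g h = begin
      (f * g) ∧ h                        ≈⟨ wedge-antisym (f * g) h ⟩
      - (h ∧ (f * g))                    ≈⟨ -‿cong (D-* (wedgeDerivation h) f g) ⟩
      - (f * (h ∧ g) + g * (h ∧ f))      ≈⟨ ⁻¹-∙-comm _ _ ⟨
      - (f * (h ∧ g)) + - (g * (h ∧ f))  ≈⟨ +-cong (-‿distribʳ-* f _) (-‿distribʳ-* g _) ⟩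
      f * - (h ∧ g) + g * - (h ∧ f)      ≈⟨ +-cong (*-congˡ (wedge-antisym g h)) (*-congˡ (wedge-antisym f h)) ⟨
      f * (g ∧ h) + g * (f ∧ h)          ∎

    wedge-inverse : ∀ {u v} → u * v ≈ 1# → u ∧ v ≈ 0#
    wedge-inverse {u} {v} uv≈1 = begin
      u ∧ v                 ≈⟨ D-inverse (wedgeDerivation u) uv≈1 ⟩
      - (v * v * (u ∧ u))   ≈⟨ -‿cong (*-congˡ (wedge-self u)) ⟩
      - (v * v * 0#)        ≈⟨ -‿cong (zeroʳ _) ⟩
      - 0#                  ≈⟨ ε⁻¹≈ε ⟩
      0#                    ∎

    -- Writing r = C X⁻¹, the form Ω = X · r⁻¹ and a = 1 − r, so dΩ ∧ da = −r⁻¹ dX ∧ dr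
    -- and dX ∧ dr = X⁻¹ dX ∧ dC.
    wedge-Ωfun-afun : ∀ {X X⁻¹ C C⁻¹} → X * X⁻¹ ≈ 1# → C * C⁻¹ ≈ 1# →
                      Ωfun R X C⁻¹ ∧ afun R C X⁻¹ ≈ - (C⁻¹ * (X ∧ C))
    wedge-Ωfun-afun {X} {X⁻¹} {C} {C⁻¹} XX⁻¹≈1 CC⁻¹≈1 = begin
      (X * X * C⁻¹) ∧ (1# - r)               ≈⟨ D-1#- (wedgeDerivation (X * X * C⁻¹)) r ⟩
      - ((X * X * C⁻¹) ∧ r)                  ≈⟨ -‿cong (wedge-cong (*-assoc X X C⁻¹) refl) ⟩
      - ((X * r⁻¹) ∧ r)                      ≈⟨ -‿cong (wedge-*ˡ X r⁻¹ r) ⟩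
      - (X * (r⁻¹ ∧ r) + r⁻¹ * (X ∧ r))      ≈⟨ -‿cong (+-cong (*-congˡ (wedge-inverse r⁻¹r≈1)) (*-congˡ X∧r≈X⁻¹*X∧C)) ⟩
      - (X * 0# + r⁻¹ * (X⁻¹ * (X ∧ C)))     ≈⟨ -‿cong (trans (+-congʳ (zeroʳ X)) (+-identityˡ _)) ⟩
      - (r⁻¹ * (X⁻¹ * (X ∧ C)))              ≈⟨ -‿cong (*-assoc r⁻¹ X⁻¹ _) ⟨
      - (r⁻¹ * X⁻¹ * (X ∧ C))                ≈⟨ -‿cong (*-congʳ r⁻¹X⁻¹≈C⁻¹) ⟩
      - (C⁻¹ * (X ∧ C))                      ∎
      where
      r = C * X⁻¹
      r⁻¹ = X * C⁻¹

      r⁻¹r≈1 : r⁻¹ * r ≈ 1#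
      r⁻¹r≈1 = begin
        (X * C⁻¹) * (C * X⁻¹)   ≈⟨ *-congˡ (*-comm C X⁻¹) ⟩
        (X * C⁻¹) * (X⁻¹ * C)   ≈⟨ interchange X C⁻¹ X⁻¹ C ⟩
        (X * X⁻¹) * (C⁻¹ * C)   ≈⟨ *-cong XX⁻¹≈1 (trans (*-comm C⁻¹ C) CC⁻¹≈1) ⟩
        1# * 1#                 ≈⟨ *-identityˡ 1# ⟩
        1#                      ∎

      X∧r≈X⁻¹*X∧C : X ∧ r ≈ X⁻¹ * (X ∧ C)
      X∧r≈X⁻¹*X∧C = begin
        X ∧ (C * X⁻¹)                       ≈⟨ D-* (wedgeDerivation X) C X⁻¹ ⟩
        C * (X ∧ X⁻¹) + X⁻¹ * (X ∧ C)       ≈⟨ +-congʳ (trans (*-congˡ (wedge-inverse XX⁻¹≈1)) (zeroʳ C)) ⟩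
        0# + X⁻¹ * (X ∧ C)                  ≈⟨ +-identityˡ _ ⟩
        X⁻¹ * (X ∧ C)                       ∎

      r⁻¹X⁻¹≈C⁻¹ : r⁻¹ * X⁻¹ ≈ C⁻¹
      r⁻¹X⁻¹≈C⁻¹ = begin
        X * C⁻¹ * X⁻¹     ≈⟨ xy∙z≈y∙xz X C⁻¹ X⁻¹ ⟩
        C⁻¹ * (X * X⁻¹)   ≈⟨ *-congˡ XX⁻¹≈1 ⟩
        C⁻¹ * 1#          ≈⟨ *-identityʳ C⁻¹ ⟩
        C⁻¹               ∎

    wedge-*-pow : ∀ x y m → (x * y) ∧ pow R x m ≈ - (natR R m * pow R x m * (x ∧ y))
    wedge-*-pow x y m = begin
      (x * y) ∧ P                    ≈⟨ wedge-*ˡ x y P ⟩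
      x * (y ∧ P) + y * (x ∧ P)      ≈⟨ +-cong (x*D-pow (wedgeDerivation y) x m)
                                               (*-congˡ (D-pow-constant (wedgeDerivation x) (wedge-self x) m)) ⟩
      N * P * (y ∧ x) + y * 0#       ≈⟨ trans (+-congˡ (zeroʳ y)) (+-identityʳ _) ⟩
      N * P * (y ∧ x)                ≈⟨ *-congˡ (wedge-antisym y x) ⟩
      N * P * - (x ∧ y)              ≈⟨ -‿distribʳ-* _ _ ⟨
      - (N * P * (x ∧ y))            ∎
      where
      P = pow R x m
      N = natR R m

    wedge-Ωfun-afun-constellation : ∀ {X X⁻¹ C C⁻¹} x y m → X * X⁻¹ ≈ 1# → C * C⁻¹ ≈ 1# →
                                    X ≈ x * y → C ≈ pow R x m →
                                    Ωfun R X C⁻¹ ∧ afun R C X⁻¹ ≈ natR R m * (x ∧ y)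
    wedge-Ωfun-afun-constellation {X} {X⁻¹} {C} {C⁻¹} x y m XX⁻¹≈1 CC⁻¹≈1 X≈xy C≈xᵐ = begin
      Ωfun R X C⁻¹ ∧ afun R C X⁻¹          ≈⟨ wedge-Ωfun-afun XX⁻¹≈1 CC⁻¹≈1 ⟩
      - (C⁻¹ * (X ∧ C))                    ≈⟨ -‿cong (*-congˡ (wedge-cong X≈xy C≈xᵐ)) ⟩
      - (C⁻¹ * ((x * y) ∧ pow R x m))      ≈⟨ -‿cong (*-congˡ (wedge-*-pow x y m)) ⟩
      - (C⁻¹ * - (N * pow R x m * w))      ≈⟨ -‿cong (-‿distribʳ-* C⁻¹ _) ⟨
      - - (C⁻¹ * (N * pow R x m * w))      ≈⟨ ⁻¹-involutive _ ⟩
      C⁻¹ * (N * pow R x m * w)            ≈⟨ *-congˡ (*-congʳ (*-congˡ C≈xᵐ)) ⟨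
      C⁻¹ * (N * C * w)
        ≈⟨ solve 4 (λ C⁻¹ N C w → C⁻¹ :* (N :* C :* w) := (C :* C⁻¹) :* (N :* w)) refl C⁻¹ N C w ⟩
      (C * C⁻¹) * (N * w)                  ≈⟨ *-congʳ CC⁻¹≈1 ⟩
      1# * (N * w)                         ≈⟨ *-identityˡ _ ⟩
      N * w                                ∎
      where
      N = natR R m
      w = x ∧ y

module HomomorphismProperties
  {c₁ ℓ₁ c₂ ℓ₂} (S : CommutativeRing c₁ ℓ₁) (R : CommutativeRing c₂ ℓ₂)
  {φ : CommutativeRing.Carrier S → CommutativeRing.Carrier R}
  (φ-hom : RingMorphisms.IsRingHomomorphism (CommutativeRing.rawRing S) (CommutativeRing.rawRing R) φ)
  where
  private module S = CommutativeRing S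
  open CommutativeRing R
  open RingMorphisms.IsRingHomomorphism φ-hom

  φ-inverse : ∀ {u v} → u S.* v S.≈ S.1# → φ u * φ v ≈ 1#
  φ-inverse uv≈1 = trans (sym (*-homo _ _)) (trans (⟦⟧-cong uv≈1) 1#-homo)

  φ-Ωfun : ∀ ξ χ⁻¹ → φ (Ωfun S ξ χ⁻¹) ≈ Ωfun R (φ ξ) (φ χ⁻¹)
  φ-Ωfun ξ χ⁻¹ = trans (*-homo (ξ S.* ξ) χ⁻¹) (*-congʳ (*-homo ξ ξ))

  φ-afun : ∀ χ ξ⁻¹ → φ (afun S χ ξ⁻¹) ≈ afun R (φ χ) (φ ξ⁻¹)
  φ-afun χ ξ⁻¹ =
    trans (+-homo S.1# _) (+-cong 1#-homo (trans (-‿homo _) (-‿cong (*-homo χ ξ⁻¹))))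

-- The identity holds for every m.
proposition2p3 : ∀ {c₁ ℓ₁ c₂ ℓ₂} (S : CommutativeRing c₁ ℓ₁) (R : CommutativeRing c₂ ℓ₂)
    (φ* : CommutativeRing.Carrier S → CommutativeRing.Carrier R)
    → RingMorphisms.IsRingHomomorphism (CommutativeRing.rawRing S) (CommutativeRing.rawRing R) φ*
    → (m : ℕ) → 2 ≤ m
    → (x y : CommutativeRing.Carrier R)
    → (ξ χ ξ⁻¹ χ⁻¹ : CommutativeRing.Carrier S)
    → CommutativeRing._≈_ S (CommutativeRing._*_ S ξ ξ⁻¹) (CommutativeRing.1# S)
    → CommutativeRing._≈_ S (CommutativeRing._*_ S χ χ⁻¹) (CommutativeRing.1# S)
    → CommutativeRing._≈_ R (φ* ξ) (CommutativeRing._*_ R x y)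
    → CommutativeRing._≈_ R (φ* χ) (pow R x m)
    → (D₁ D₂ : Derivation R)
    → CommutativeRing._≈_ R (wedge R D₁ D₂ (φ* (Ωfun S ξ χ⁻¹)) (φ* (afun S χ ξ⁻¹))) (CommutativeRing._*_ R (natR R m) (wedge R D₁ D₂ x y))
proposition2p3 S R φ* φ*-hom m _ x y ξ χ ξ⁻¹ χ⁻¹ ξξ⁻¹≈1 χχ⁻¹≈1 φξ≈xy φχ≈xᵐ D₁ D₂ =
  trans (wedge-cong D₁ D₂ (φ-Ωfun ξ χ⁻¹) (φ-afun χ ξ⁻¹))
        (wedge-Ωfun-afun-constellation D₁ D₂ x y m (φ-inverse ξξ⁻¹≈1) (φ-inverse χχ⁻¹≈1) φξ≈xy φχ≈xᵐ)
  where
  open CommutativeRing R using (trans)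
  open DifferentialCalculus R using (wedge-cong; wedge-Ωfun-afun-constellation)
  open HomomorphismProperties S R φ*-hom
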